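{- Let $n$ be a positive integer. Then: (1) a pair of compositions $((a,b),(c))$ of $n$ (so $a+b=c=n$) is a lieander if and only if $\gcd(a,n)=1$; (2) a pair of compositions $((a,b,c),(d))$ of $n$ (so $a+b+c=d=n$) is a lieander if and only if $\gcd(a+b,b+c)=1$; (3) a pair of compositions $((a,b),(c,d))$ of $n$ (so $a+b=c+d=n$) is a lieander if and only if $\gcd(a+d,n)=1$.
   Context: A composition of a positive integer $n$ is a finite sequence $c=(c_1,\ldots,c_k)$ of positive integers with $c_1+\cdots+c_k=n$; $k$ is its length. To such a composition associate the fixed-point-free involution $\sigma_c$ of $\{1,\ldots,2n\}$ defined as follows: split $\{1,\ldots,2n\}$ into consecutive intervals $I_1=\{1,\ldots,2c_1\}$, $I_2=\{2c_1+1,\ldots,2(c_1+c_2)\}$, \ldots, $I_k=\{2(c_1+\cdots+c_{k-1})+1,\ldots,2n\}$, and let $\sigma_c$ be the involution reversing the order on each $I_j$. A pair $(c^+,c^-)$ of compositions of the same integer $n$ is a lieander if the group $\langle \sigma_{c^+},\sigma_{c^- }\rangle$ acts transitively on $\{1,\ldots,2n\}$ (equivalently, $\sigma_{c^+}\sigma_{c^- }$ is a product of two $n$-cycles). -}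

module Defs where

open import Data.Nat using (ℕ; zero; suc; _+_; _*_; _∸_; _≤_; _<_; _≤ᵇ_)
open import Data.Bool using (if_then_else_)
open import Data.List using (List; []; _∷_)
open import Data.Nat.ListAction using (sum)
open import Data.List.Relation.Unary.All using (All)
open import Data.Product using (_×_)
open import Relation.Binary.PropositionalEquality using (_≡_)

IsComposition : ℕ → List ℕ → Set
IsComposition n c = All (λ x → 0 < x) c × sum c ≡ n

-- σ_c acting on points 1..2n (1-based, as in the paper): the first block
-- I₁ = {1,…,2c₁} is reversed (i ↦ 2c₁+1−i), and the remaining points are
-- shifted by 2c₁ and handled recursively by the rest of the composition.
σ : List ℕ → ℕ → ℕ
σ [] i = i
σ (c ∷ cs) i = if i ≤ᵇ 2 * c then suc (2 * c) ∸ i else 2 * c + σ cs (i ∸ 2 * c)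

-- Orbit relation of the group generated by two involutions f, g
-- (the inverses of the generators are the generators themselves).
data Reach (f g : ℕ → ℕ) (x : ℕ) : ℕ → Set where
  here  : Reach f g x x
  stepf : ∀ {y} → Reach f g x y → Reach f g x (f y)
  stepg : ∀ {y} → Reach f g x y → Reach f g x (g y)

IsLieander : ℕ → List ℕ → List ℕ → Set
IsLieander n c⁺ c⁻ =
  IsComposition n c⁺ × IsComposition n c⁻ ×
  (∀ x y → 1 ≤ x → x ≤ 2 * n → 1 ≤ y → y ≤ 2 * n → Reach (σ c⁺) (σ c⁻) x y)

{-# OPTIONS --safe #-}
module Submission where

-- When c has at most two parts, σ_c acts on {1, …, 2n} as a reflection x ↦ 2p + 1 − x of
-- ℤ/2n, p being the first part.  Two such reflections f, g compose to the rotation by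
-- 2(p − q), and each of them exchanges the two parity classes, so ⟨f, g⟩ is transitive as
-- soon as gcd(p − q, n) = 1; conversely, for d = gcd(p − q, n) both act modulo 2d as the same
-- reflection, so the classes of 0 and 2p + 1 modulo 2d form an invariant set, which misses 2
-- unless d = 1.  This settles (1) and (3).  For (2), after conjugating by σ_(n) (which
-- reverses the composition) we may assume c ≤ a + b; then σ_(n) folds the last block of
-- σ_(a,b,c) onto {1, …, 2c}, and the orbits correspond to those of the pair
-- (σ_(a,b), σ_(c, a+b−c)) on {1, …, 2(a + b)}, which falls under (3).

open import Defs
open import Data.Nat.Base using (ℕ; zero; suc; _≤_; _<_; z≤n; s≤s; s≤s⁻¹)
open import Data.List.Base using (List; []; _∷_; _++_; reverse)
open import Data.Product.Base using (_×_; _,_; proj₁; proj₂; ∃-syntax)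
open import Data.Sum.Base using (_⊎_; inj₁; inj₂; [_,_]′)
open import Data.Bool.Base using (true; false)
open import Data.Empty using (⊥; ⊥-elim)
open import Function.Base using (id)
open import Function.Bundles using (_⇔_; mk⇔)
open import Relation.Binary.PropositionalEquality
  using (_≡_; _≢_; refl; sym; trans; cong; cong₂; subst; subst₂; module ≡-Reasoning)

module Orbits where

  InRange : ℕ → ℕ → Set
  InRange N x = 1 ≤ x × x ≤ N

  ActsTransitively : ℕ → (ℕ → ℕ) → (ℕ → ℕ) → Set
  ActsTransitively N f g =
    ∀ x y → 1 ≤ x → x ≤ N → 1 ≤ y → y ≤ N → Reach f g x y

  private
    variable
      N : ℕ
      x y z : ℕ
      f g f′ g′ : ℕ → ℕ

  Reach-≡ : x ≡ y → Reach f g x y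
  Reach-≡ refl = here

  Reach-trans : Reach f g x y → Reach f g y z → Reach f g x z
  Reach-trans r here      = r
  Reach-trans r (stepf s) = stepf (Reach-trans r s)
  Reach-trans r (stepg s) = stepg (Reach-trans r s)

  Reach-swap : Reach f g x y → Reach g f x y
  Reach-swap here      = here
  Reach-swap (stepf r) = stepg (Reach-swap r)
  Reach-swap (stepg r) = stepf (Reach-swap r)

  Reach-invariant : (P : ℕ → Set) →
    (∀ {z} → P z → P (f z)) → (∀ {z} → P z → P (g z)) →
    Reach f g x y → P x → P y
  Reach-invariant P Pf Pg here      Px = Px
  Reach-invariant P Pf Pg (stepf r) Px = Pf (Reach-invariant P Pf Pg r Px)
  Reach-invariant P Pf Pg (stepg r) Px = Pg (Reach-invariant P Pf Pg r Px)

  Reach-map : (P : ℕ → Set) (h : ℕ → ℕ) →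
    (∀ {z} → P z → P (f z)) → (∀ {z} → P z → P (g z)) →
    (∀ {z} → P z → Reach f′ g′ (h z) (h (f z))) →
    (∀ {z} → P z → Reach f′ g′ (h z) (h (g z))) →
    Reach f g x y → P x → Reach f′ g′ (h x) (h y)
  Reach-map P h Pf Pg hf hg here      Px = here
  Reach-map P h Pf Pg hf hg (stepf r) Px =
    Reach-trans (Reach-map P h Pf Pg hf hg r Px) (hf (Reach-invariant P Pf Pg r Px))
  Reach-map P h Pf Pg hf hg (stepg r) Px =
    Reach-trans (Reach-map P h Pf Pg hf hg r Px) (hg (Reach-invariant P Pf Pg r Px))

  ActsTransitively-swap : ActsTransitively N f g ⇔ ActsTransitively N g f
  ActsTransitively-swap = mk⇔ swap swap
    where
    swap : ∀ {N f g} → ActsTransitively N f g → ActsTransitively N g f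
    swap T x y x≥1 x≤N y≥1 y≤N = Reach-swap (T x y x≥1 x≤N y≥1 y≤N)

  PreservesRange : ℕ → (ℕ → ℕ) → Set
  PreservesRange N f = ∀ {x} → InRange N x → InRange N (f x)

  ActsTransitively-conjugate : (h : ℕ → ℕ) →
    PreservesRange N h → (∀ {x} → InRange N x → h (h x) ≡ x) →
    PreservesRange N f → PreservesRange N g →
    (∀ {x} → InRange N x → h (f x) ≡ f′ (h x)) →
    (∀ {x} → InRange N x → h (g x) ≡ g′ (h x)) →
    ActsTransitively N f g → ActsTransitively N f′ g′
  ActsTransitively-conjugate {f′ = f′} {g′ = g′} h h-range h-involutive
    f-range g-range hf hg T x y x≥1 x≤N y≥1 y≤N =
    subst₂ (Reach f′ g′) (h-involutive (x≥1 , x≤N)) (h-involutive (y≥1 , y≤N))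
      (Reach-map (InRange _) h f-range g-range
        (λ Pz → subst (Reach f′ g′ _) (sym (hf Pz)) (stepf here))
        (λ Pz → subst (Reach f′ g′ _) (sym (hg Pz)) (stepg here))
        (T (h x) (h y) (proj₁ hx) (proj₂ hx) (proj₁ hy) (proj₂ hy)) hx)
    where
    hx = h-range (x≥1 , x≤N)
    hy = h-range (y≥1 , y≤N)

  record Reduction (N M : ℕ) (f g f′ g′ : ℕ → ℕ) : Set where
    field
      M≤N            : M ≤ N
      f-range        : PreservesRange N f
      g-range        : PreservesRange N g
      f′-range       : PreservesRange M f′
      g′-range       : PreservesRange M g′
      f′-reach       : ∀ {y} → InRange M y → Reach f g y (f′ y)
      g′-reach       : ∀ {y} → InRange M y → Reach f g y (g′ y)
      project        : ℕ → ℕ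
      project-range  : ∀ {x} → InRange N x → InRange M (project x)
      project-small  : ∀ {y} → InRange M y → project y ≡ y
      project-reach  : ∀ {x} → InRange N x → Reach f g x (project x)
      project-reach⁻ : ∀ {x} → InRange N x → Reach f g (project x) x
      project-f      : ∀ {x} → InRange N x → Reach f′ g′ (project x) (project (f x))
      project-g      : ∀ {x} → InRange N x → Reach f′ g′ (project x) (project (g x))

  Reduction⇒ActsTransitively⇔ : ∀ {M} → Reduction N M f g f′ g′ →
    ActsTransitively N f g ⇔ ActsTransitively M f′ g′
  Reduction⇒ActsTransitively⇔ {N} {f} {g} {f′} {g′} {M} R = mk⇔ restrict extend
    where
    open Reduction R
    open import Data.Nat.Properties using (≤-trans)

    restrict : ActsTransitively N f g → ActsTransitively M f′ g′
    restrict T x y x≥1 x≤M y≥1 y≤M =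
      subst₂ (Reach f′ g′) (project-small (x≥1 , x≤M)) (project-small (y≥1 , y≤M))
        (Reach-map (InRange N) project f-range g-range project-f project-g
          (T x y x≥1 (≤-trans x≤M M≤N) y≥1 (≤-trans y≤M M≤N))
          (x≥1 , ≤-trans x≤M M≤N))

    extend : ActsTransitively M f′ g′ → ActsTransitively N f g
    extend T x y x≥1 x≤N y≥1 y≤N =
      Reach-trans (project-reach (x≥1 , x≤N))
        (Reach-trans small-path (project-reach⁻ (y≥1 , y≤N)))
      where
      px = project-range (x≥1 , x≤N)
      py = project-range (y≥1 , y≤N)
      small-path : Reach f g (project x) (project y)
      small-path = Reach-map (InRange M) id f′-range g′-range f′-reach g′-reach
        (T (project x) (project y) (proj₁ px) (proj₂ px) (proj₁ py) (proj₂ py)) px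

module Blocks where

  open import Data.Nat.Base using (_+_; _*_; _∸_; _≤ᵇ_)
  open import Data.Nat.Properties
    using (≤-trans; _≤?_; ≰⇒>; m≤n⇒∃[o]m+o≡n; +-suc; +-comm; +-assoc;
           m<m+n; m≤m+n; m≤n+m; m+n∸m≡n; m+1+n≰m; +-cancelˡ-≤; +-monoʳ-≤;
           *-distribˡ-+; *-monoʳ-≤; ≤ᵇ-reflects-≤; +-cancelˡ-≡; <⇒≱)
  open import Data.Nat.ListAction using (sum)
  open import Data.Nat.ListAction.Properties using (sum-↭)
  open import Data.Nat.Tactic.RingSolver using (solve-∀)
  open import Data.List.Properties using (unfold-reverse)
  open import Data.List.Relation.Binary.Permutation.Propositional.Properties
    using (↭-reverse)
  open import Relation.Nullary.Decidable.Core using (yes; no)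
  open import Relation.Nullary.Reflects using (ofʸ; ofⁿ)
  open Orbits

  -- x and y are exchanged by the reversal of the block {1, …, 2c}.
  record Mirror (c x y : ℕ) : Set where
    constructor mirror
    field
      left>0  : 0 < x
      right>0 : 0 < y
      sum≡    : x + y ≡ suc (2 * c)

  private
    variable
      c d x y : ℕ

  Mirror-sym : Mirror c x y → Mirror c y x
  Mirror-sym {x = x} {y} (mirror x>0 y>0 x+y) = mirror y>0 x>0 (trans (+-comm y x) x+y)

  Mirror⇒≤ : Mirror c x y → x ≤ 2 * c
  Mirror⇒≤ {x = x} (mirror _ y>0 x+y) = s≤s⁻¹ (subst (suc x ≤_) x+y (m<m+n x y>0))

  Mirror-exists : ∀ c → InRange (2 * c) x → ∃[ y ] Mirror c x y
  Mirror-exists {x = x} c (x≥1 , x≤2c) with m≤n⇒∃[o]m+o≡n x≤2c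
  ... | o , x+o = suc o , mirror x≥1 (s≤s z≤n) (trans (+-suc x o) (cong suc x+o))

  Mirror-range : Mirror c x y → InRange (2 * c) x
  Mirror-range m@(mirror x>0 _ _) = x>0 , Mirror⇒≤ m

  Mirror-unique : ∀ {y′} → Mirror c x y → Mirror c x y′ → y ≡ y′
  Mirror-unique {x = x} {y} {y′} (mirror _ _ x+y) (mirror _ _ x+y′) =
    +-cancelˡ-≡ x y y′ (trans x+y (sym x+y′))

  Mirror-shiftˡ : ∀ c → Mirror d x y → Mirror (c + d) (2 * c + x) y
  Mirror-shiftˡ {d} {x} {y} c (mirror x>0 y>0 x+y) =
    mirror (≤-trans x>0 (m≤n+m x (2 * c))) y>0 (begin
      2 * c + x + y       ≡⟨ +-assoc (2 * c) x y ⟩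
      2 * c + (x + y)     ≡⟨ cong (2 * c +_) x+y ⟩
      2 * c + suc (2 * d) ≡⟨ collect c d ⟩
      suc (2 * (c + d))   ∎)
    where
    open ≡-Reasoning
    collect : ∀ c d → 2 * c + suc (2 * d) ≡ suc (2 * (c + d))
    collect = solve-∀

  Mirror-shiftʳ : ∀ c → Mirror d x y → Mirror (c + d) x (2 * c + y)
  Mirror-shiftʳ c m = Mirror-sym (Mirror-shiftˡ c (Mirror-sym m))

  Mirror-unshiftˡ : 0 < x → Mirror (c + d) (2 * c + x) y → Mirror d x y
  Mirror-unshiftˡ {x} {c} {d} {y} x>0 (mirror _ y>0 sum≡) =
    mirror x>0 y>0 (+-cancelˡ-≡ (2 * c) (x + y) (suc (2 * d)) (begin
      2 * c + (x + y)     ≡⟨ sym (+-assoc (2 * c) x y) ⟩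
      2 * c + x + y       ≡⟨ sum≡ ⟩
      suc (2 * (c + d))   ≡⟨ spread c d ⟩
      2 * c + suc (2 * d) ∎))
    where
    open ≡-Reasoning
    spread : ∀ c d → suc (2 * (c + d)) ≡ 2 * c + suc (2 * d)
    spread = solve-∀

  data Block (c : ℕ) : ℕ → Set where
    inside : ∀ {x} → x ≤ 2 * c → Block c x
    beyond : ∀ w → Block c (2 * c + suc w)

  block : ∀ c x → Block c x
  block c x with x ≤? 2 * c
  ... | yes x≤2c = inside x≤2c
  ... | no  x≰2c with m≤n⇒∃[o]m+o≡n (≰⇒> x≰2c)
  ...   | w , refl = subst (Block c) (+-suc (2 * c) w) (beyond w)

  σ-mirror : ∀ cs → Mirror c x y → σ (c ∷ cs) x ≡ y
  σ-mirror {c} {x} {y} cs m@(mirror _ _ x+y) with x ≤ᵇ 2 * c | ≤ᵇ-reflects-≤ x (2 * c)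
  ... | true  | _       = trans (cong (_∸ x) (sym x+y)) (m+n∸m≡n x y)
  ... | false | ofⁿ x≰ = ⊥-elim (x≰ (Mirror⇒≤ m))

  σ-beyond : ∀ c cs w → σ (c ∷ cs) (2 * c + suc w) ≡ 2 * c + σ cs (suc w)
  σ-beyond c cs w with 2 * c + suc w ≤ᵇ 2 * c | ≤ᵇ-reflects-≤ (2 * c + suc w) (2 * c)
  ... | true  | ofʸ le = ⊥-elim (m+1+n≰m (2 * c) le)
  ... | false | _      = cong (λ v → 2 * c + σ cs v) (m+n∸m≡n (2 * c) (suc w))

  beyond-bound : ∀ c S w → 2 * c + suc w ≤ 2 * (c + S) → suc w ≤ 2 * S
  beyond-bound c S w le =
    +-cancelˡ-≤ (2 * c) (suc w) (2 * S) (subst (2 * c + suc w ≤_) (*-distribˡ-+ 2 c S) le)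

  σ-single-mirror : ∀ n → InRange (2 * n) x → Mirror n x (σ (n ∷ []) x)
  σ-single-mirror n x∈ with Mirror-exists n x∈
  ... | _ , m = subst (Mirror n _) (sym (σ-mirror [] m)) m

  σ-pair-mirror : ∀ a b → InRange (2 * (a + b)) x →
    Mirror a x (σ (a ∷ b ∷ []) x) ⊎ Mirror (a + (a + b)) x (σ (a ∷ b ∷ []) x)
  σ-pair-mirror {x} a b (x≥1 , x≤) with block a x
  ... | inside x≤2a with Mirror-exists a (x≥1 , x≤2a)
  ...   | _ , m = inj₁ (subst (Mirror a x) (sym (σ-mirror (b ∷ []) m)) m)
  σ-pair-mirror a b (x≥1 , x≤) | beyond w with Mirror-exists b (s≤s z≤n , beyond-bound a b w x≤)
  ... | _ , m = inj₂ (subst (Mirror (a + (a + b)) _)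
                      (sym (trans (σ-beyond a (b ∷ []) w) (cong (2 * a +_) (σ-mirror [] m))))
                      (Mirror-shiftʳ a (Mirror-shiftˡ a m)))

  σ-range′ : ∀ cs → PreservesRange (2 * sum cs) (σ cs)
  σ-range′ [] (x≥1 , x≤0) = ⊥-elim (<⇒≱ x≥1 x≤0)
  σ-range′ (c ∷ cs) {x} (x≥1 , x≤) with block c x
  ... | inside x≤2c with Mirror-exists c (x≥1 , x≤2c)
  ...   | y , m = subst (InRange (2 * (c + sum cs))) (sym (σ-mirror cs m))
                    (Mirror.right>0 m , ≤-trans (Mirror⇒≤ (Mirror-sym m)) (*-monoʳ-≤ 2 (m≤m+n c (sum cs))))
  σ-range′ (c ∷ cs) (x≥1 , x≤) | beyond w
    with σ-range′ cs (s≤s z≤n , beyond-bound c (sum cs) w x≤)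
  ... | σ≥1 , σ≤ = subst (InRange (2 * (c + sum cs))) (sym (σ-beyond c cs w))
      ( ≤-trans σ≥1 (m≤n+m _ (2 * c))
      , subst (2 * c + σ cs (suc w) ≤_) (sym (*-distribˡ-+ 2 c (sum cs))) (+-monoʳ-≤ (2 * c) σ≤))

  σ-range : ∀ {n} cs → sum cs ≡ n → PreservesRange (2 * n) (σ cs)
  σ-range cs refl = σ-range′ cs

  σ-++ˡ : ∀ cs ds → InRange (2 * sum cs) x → σ (cs ++ ds) x ≡ σ cs x
  σ-++ˡ [] ds (x≥1 , x≤0) = ⊥-elim (<⇒≱ x≥1 x≤0)
  σ-++ˡ {x} (c ∷ cs) ds (x≥1 , x≤) with block c x
  ... | inside x≤2c with Mirror-exists c (x≥1 , x≤2c)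
  ...   | _ , m = trans (σ-mirror (cs ++ ds) m) (sym (σ-mirror cs m))
  σ-++ˡ (c ∷ cs) ds (x≥1 , x≤) | beyond w = begin
    σ (c ∷ cs ++ ds) (2 * c + suc w) ≡⟨ σ-beyond c (cs ++ ds) w ⟩
    2 * c + σ (cs ++ ds) (suc w)     ≡⟨ cong (2 * c +_) (σ-++ˡ cs ds w∈) ⟩
    2 * c + σ cs (suc w)             ≡⟨ σ-beyond c cs w ⟨
    σ (c ∷ cs) (2 * c + suc w)       ∎
    where
    open ≡-Reasoning
    w∈ = s≤s z≤n , beyond-bound c (sum cs) w x≤

  σ-++ʳ : ∀ cs ds w → σ (cs ++ ds) (2 * sum cs + suc w) ≡ 2 * sum cs + σ ds (suc w)
  σ-++ʳ []       ds w = refl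
  σ-++ʳ (c ∷ cs) ds w = begin
    σ (c ∷ cs ++ ds) (2 * (c + S) + suc w)   ≡⟨ cong (σ (c ∷ cs ++ ds)) (regroup c S w) ⟩
    σ (c ∷ cs ++ ds) (2 * c + suc (2 * S + w)) ≡⟨ σ-beyond c (cs ++ ds) (2 * S + w) ⟩
    2 * c + σ (cs ++ ds) (suc (2 * S + w))   ≡⟨ cong (λ v → 2 * c + σ (cs ++ ds) v) (+-suc (2 * S) w) ⟨
    2 * c + σ (cs ++ ds) (2 * S + suc w)     ≡⟨ cong (2 * c +_) (σ-++ʳ cs ds w) ⟩
    2 * c + (2 * S + σ ds (suc w))           ≡⟨ reassoc c S (σ ds (suc w)) ⟩
    2 * (c + S) + σ ds (suc w)               ∎
    where
    open ≡-Reasoning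
    S = sum cs
    regroup : ∀ c S w → 2 * (c + S) + suc w ≡ 2 * c + suc (2 * S + w)
    regroup = solve-∀
    reassoc : ∀ c S v → 2 * c + (2 * S + v) ≡ 2 * (c + S) + v
    reassoc = solve-∀

  sum-reverse : ∀ cs → sum (reverse cs) ≡ sum cs
  sum-reverse cs = sum-↭ (↭-reverse cs)

  σ-reverse : ∀ cs → Mirror (sum cs) x y → Mirror (sum cs) (σ cs x) (σ (reverse cs) y)
  σ-reverse [] m = ⊥-elim (<⇒≱ (Mirror.left>0 m) (Mirror⇒≤ m))
  σ-reverse {x} {y} (c ∷ cs) m =
    subst (λ ds → Mirror (c + S) (σ (c ∷ cs) x) (σ ds y)) (sym (unfold-reverse c cs)) (snoc m)
    where
    S = sum cs
    open ≡-Reasoning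

    snoc : ∀ {x y} → Mirror (c + S) x y →
           Mirror (c + S) (σ (c ∷ cs) x) (σ (reverse cs ++ c ∷ []) y)
    snoc {x} {y} m with block c x
    ... | inside x≤2c with Mirror-exists c (Mirror.left>0 m , x≤2c)
    ...   | zero  , mirror _ () _
    ...   | suc v , m̄ = subst₂ (Mirror (c + S)) (sym (σ-mirror cs m̄)) (sym σy≡)
                          (subst (λ s → Mirror s (suc v) (2 * S + x)) (+-comm S c)
                            (Mirror-shiftʳ S (Mirror-sym m̄)))
      where
      y≡ : y ≡ 2 * S + suc v
      y≡ = Mirror-unique m (subst (λ s → Mirror s x (2 * S + suc v)) (+-comm S c) (Mirror-shiftʳ S m̄))
      σy≡ : σ (reverse cs ++ c ∷ []) y ≡ 2 * S + x
      σy≡ = begin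
        σ (reverse cs ++ c ∷ []) y
          ≡⟨ cong (σ (reverse cs ++ c ∷ [])) y≡ ⟩
        σ (reverse cs ++ c ∷ []) (2 * S + suc v)
          ≡⟨ cong (λ s → σ (reverse cs ++ c ∷ []) (2 * s + suc v)) (sum-reverse cs) ⟨
        σ (reverse cs ++ c ∷ []) (2 * sum (reverse cs) + suc v)
          ≡⟨ σ-++ʳ (reverse cs) (c ∷ []) v ⟩
        2 * sum (reverse cs) + σ (c ∷ []) (suc v)
          ≡⟨ cong₂ (λ s t → 2 * s + t) (sum-reverse cs) (σ-mirror [] (Mirror-sym m̄)) ⟩
        2 * S + x ∎
    snoc {y = y} m | beyond w =
      subst₂ (Mirror (c + S)) (sym (σ-beyond c cs w)) (sym σy≡) (Mirror-shiftˡ c (σ-reverse cs m′))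
      where
      m′ : Mirror S (suc w) y
      m′ = Mirror-unshiftˡ (s≤s z≤n) m
      σy≡ : σ (reverse cs ++ c ∷ []) y ≡ σ (reverse cs) y
      σy≡ = σ-++ˡ (reverse cs) (c ∷ [])
              (subst (λ s → InRange (2 * s) y) (sym (sum-reverse cs)) (Mirror-range (Mirror-sym m′)))

module Congruences where

  import Data.Nat.Base as ℕ
  open import Data.Nat.Base using (NonZero)
  import Data.Nat.Properties as ℕ
  import Data.Nat.Divisibility as ℕ
  open import Data.Nat.GCD using (gcd; GCD; gcd-GCD; module Bézout)
  open import Data.Integer.Base using (ℤ; +_; -_; _+_; _-_; _*_; _%ℕ_; _/ℕ_)
  open import Data.Integer.Properties using (pos-+; pos-*; +-inverseʳ)
  open import Data.Integer.DivMod using (a≡a%ℕn+[a/ℕn]*n; n%ℕd<d)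
  open import Data.Integer.Divisibility.Signed
    using (_∣_; divides; ∣-refl; ∣-trans; ∣ᵤ⇒∣; ∣⇒∣ᵤ;
           ∣m∣n⇒∣m+n; ∣m+n∣m⇒∣n; ∣m⇒∣-m; ∣m⇒∣m*n; ∣n⇒∣m*n)
  open import Data.Integer.Tactic.RingSolver using (solve-∀)
  open import Relation.Binary.Bundles using (Setoid)
  import Relation.Binary.Reasoning.Setoid as SetoidReasoning
  open Orbits using (InRange)

  infix 4 _≈_mod_

  record _≈_mod_ (x y : ℤ) (m : ℕ) : Set where
    constructor congruent
    field
      divides-difference : + m ∣ x - y

  private
    variable
      m : ℕ
      x y z u v : ℤ

  ≡⇒≈[mod] : x ≡ y → x ≈ y mod m
  ≡⇒≈[mod] {x = x} refl = congruent (divides (+ 0) (+-inverseʳ x))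

  ≈[mod]-sym : x ≈ y mod m → y ≈ x mod m
  ≈[mod]-sym {x = x} {y = y} (congruent p) = congruent (subst (_ ∣_) (identity x y) (∣m⇒∣-m p))
    where identity : ∀ x y → - (x - y) ≡ y - x
          identity = solve-∀

  ≈[mod]-trans : x ≈ y mod m → y ≈ z mod m → x ≈ z mod m
  ≈[mod]-trans {x = x} {y = y} {z = z} (congruent p) (congruent q) =
    congruent (subst (_ ∣_) (identity x y z) (∣m∣n⇒∣m+n p q))
    where identity : ∀ x y z → (x - y) + (y - z) ≡ x - z
          identity = solve-∀

  ≈[mod]-setoid : ℕ → Setoid _ _
  ≈[mod]-setoid m = record
    { Carrier       = ℤ
    ; _≈_           = λ x y → x ≈ y mod m
    ; isEquivalence = record { refl = ≡⇒≈[mod] refl ; sym = ≈[mod]-sym ; trans = ≈[mod]-trans }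
    }

  module ≈[mod]-Reasoning (m : ℕ) = SetoidReasoning (≈[mod]-setoid m)

  +-cong[mod] : x ≈ y mod m → u ≈ v mod m → x + u ≈ y + v mod m
  +-cong[mod] {x = x} {y = y} {u = u} {v = v} (congruent p) (congruent q) =
    congruent (subst (_ ∣_) (identity x y u v) (∣m∣n⇒∣m+n p q))
    where identity : ∀ x y u v → (x - y) + (u - v) ≡ (x + u) - (y + v)
          identity = solve-∀

  +-congˡ[mod] : ∀ x → u ≈ v mod m → x + u ≈ x + v mod m
  +-congˡ[mod] x = +-cong[mod] (≡⇒≈[mod] {x = x} refl)

  +-congʳ[mod] : ∀ u → x ≈ y mod m → x + u ≈ y + u mod m
  +-congʳ[mod] u x≈y = +-cong[mod] x≈y (≡⇒≈[mod] {x = u} refl)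

  +-cancelʳ[mod] : x + z ≈ y + z mod m → x ≈ y mod m
  +-cancelʳ[mod] {x = x} {z = z} {y = y} (congruent p) = congruent (subst (_ ∣_) (identity x y z) p)
    where identity : ∀ x y z → (x + z) - (y + z) ≡ x - y
          identity = solve-∀

  *-congˡ[mod] : ∀ k → x ≈ y mod m → k * x ≈ k * y mod m
  *-congˡ[mod] {x = x} {y = y} k (congruent p) = congruent (subst (_ ∣_) (identity k x y) (∣n⇒∣m*n k p))
    where identity : ∀ k x y → k * (x - y) ≡ k * x - k * y
          identity = solve-∀

  *-scale[mod] : ∀ {m x y} c → x ≈ y mod m → + c * x ≈ + c * y mod (c ℕ.* m)
  *-scale[mod] {m} {x} {y} c (congruent (divides q eq)) = congruent (divides q (begin
    + c * x - + c * y   ≡⟨ distrib (+ c) x y ⟩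
    + c * (x - y)       ≡⟨ cong (+ c *_) eq ⟩
    + c * (q * + m)     ≡⟨ swap (+ c) q (+ m) ⟩
    q * (+ c * + m)     ≡⟨ cong (q *_) (pos-* c m) ⟨
    q * + (c ℕ.* m)     ∎))
    where
    open ≡-Reasoning
    distrib : ∀ c x y → c * x - c * y ≡ c * (x - y)
    distrib = solve-∀
    swap : ∀ c q m → c * (q * m) ≡ q * (c * m)
    swap = solve-∀

  ≈[mod]-weaken : ∀ {d} → d ℕ.∣ m → x ≈ y mod m → x ≈ y mod d
  ≈[mod]-weaken d∣m (congruent p) = congruent (∣-trans (∣ᵤ⇒∣ d∣m) p)

  +-multiple[mod] : ∀ x q → x + q * + m ≈ x mod m
  +-multiple[mod] {m} x q = congruent (divides q (identity x q (+ m)))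
    where identity : ∀ x q m → x + q * m - x ≡ q * m
          identity = solve-∀

  ∣⇒≈[mod]0 : ∀ {d k} → d ℕ.∣ k → + k ≈ + 0 mod d
  ∣⇒≈[mod]0 {d} {k} (ℕ.divides q k≡q*d) = congruent (divides (+ q) (begin
    + k - + 0     ≡⟨ minus-zero (+ k) ⟩
    + k           ≡⟨ cong +_ k≡q*d ⟩
    + (q ℕ.* d)   ≡⟨ pos-* q d ⟩
    + q * + d     ∎))
    where
    open ≡-Reasoning
    minus-zero : ∀ x → x - + 0 ≡ x
    minus-zero = solve-∀

  ≈[mod]0⇒∣ : ∀ {d k} → + k ≈ + 0 mod d → d ℕ.∣ k
  ≈[mod]0⇒∣ {d} {k} (congruent d∣k-0) = ∣⇒∣ᵤ (subst (+ d ∣_) (minus-zero (+ k)) d∣k-0)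
    where minus-zero : ∀ x → x - + 0 ≡ x
          minus-zero = solve-∀

  +≡+⇒≈[mod] : ∀ p q k {n} → p ℕ.+ n ≡ q ℕ.+ k → + p ≈ + q + + k mod n
  +≡+⇒≈[mod] p q k {n} p+n≡q+k = ≈[mod]-sym (subst (λ v → v ≈ + p mod n)
    (trans (once (+ p) (+ n)) (cong +_ p+n≡q+k)) (+-multiple[mod] (+ p) (+ 1)))
    where once : ∀ p n → p + + 1 * n ≡ p + n
          once = solve-∀

  %ℕ≈[mod] : ∀ x m .{{_ : NonZero m}} → + (x %ℕ m) ≈ x mod m
  %ℕ≈[mod] x m = ≈[mod]-sym (subst (λ w → w ≈ + (x %ℕ m) mod m)
    (sym (a≡a%ℕn+[a/ℕn]*n x m)) (+-multiple[mod] (+ (x %ℕ m)) (x /ℕ m)))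

  private
    ∣∧<⇒≡0 : ∀ {m e} → m ℕ.∣ e → e ℕ.< m → e ≡ 0
    ∣∧<⇒≡0 {e = zero}  _   _   = refl
    ∣∧<⇒≡0 {e = suc _} m∣e e<m = ⊥-elim (ℕ.>⇒∤ e<m m∣e)

    ≈[mod]-injective-≤ : ∀ {m x y} → InRange m x → InRange m y →
      + y ≈ + x mod m → x ℕ.≤ y → x ≡ y
    ≈[mod]-injective-≤ {m} {x} (x≥1 , _) (_ , y≤m) (congruent m∣y-x) x≤y
      with ℕ.m≤n⇒∃[o]m+o≡n x≤y
    ... | e , refl = sym (trans (cong (x ℕ.+_) e≡0) (ℕ.+-identityʳ x))
      where
      cancel : ∀ x e → x + e - x ≡ e
      cancel = solve-∀
      m∣e : m ℕ.∣ e
      m∣e = ∣⇒∣ᵤ (subst (_ ∣_) (trans (cong (_- + x) (pos-+ x e)) (cancel (+ x) (+ e))) m∣y-x)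
      e<m : e ℕ.< m
      e<m = ℕ.≤-trans (ℕ.+-monoˡ-≤ e x≥1) y≤m
      e≡0 : e ≡ 0
      e≡0 = ∣∧<⇒≡0 m∣e e<m

  ≈[mod]-injective : ∀ {m x y} → InRange m x → InRange m y → + x ≈ + y mod m → x ≡ y
  ≈[mod]-injective {x = x} {y} rx ry x≈y with ℕ.≤-total x y
  ... | inj₁ x≤y = ≈[mod]-injective-≤ rx ry (≈[mod]-sym x≈y) x≤y
  ... | inj₂ y≤x = sym (≈[mod]-injective-≤ ry rx x≈y y≤x)

  private
    cast-1+* : ∀ a b c d → 1 ℕ.+ a ℕ.* b ≡ c ℕ.* d → + 1 + + a * + b ≡ + c * + d
    cast-1+* a b c d eq = trans (cong (_+_ (+ 1)) (sym (pos-* a b))) (trans (cong +_ eq) (pos-* c d))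

  coprime⇒invertible : ∀ {k n} → gcd k n ≡ 1 → ∃[ u ] + k * u ≈ + 1 mod n
  coprime⇒invertible {k} {n} gcd≡1 with Bézout.identity (subst (GCD k n) gcd≡1 (gcd-GCD k n))
  ... | Bézout.+- x y eq = + x , congruent (divides (+ y) (begin
    + k * + x - + 1               ≡⟨ cong (_- + 1) (commute (+ k) (+ x)) ⟩
    + x * + k - + 1               ≡⟨ cong (_- + 1) (cast-1+* y n x k eq) ⟨
    + 1 + + y * + n - + 1         ≡⟨ cancel (+ y * + n) ⟩
    + y * + n                     ∎))
    where
    open ≡-Reasoning
    commute : ∀ a b → a * b ≡ b * a
    commute = solve-∀
    cancel : ∀ a → + 1 + a - + 1 ≡ a
    cancel = solve-∀
  ... | Bézout.-+ x y eq = - + x , congruent (divides (- + y) (begin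
    + k * - + x - + 1             ≡⟨ regroup (+ k) (+ x) ⟩
    - (+ 1 + + x * + k)           ≡⟨ cong -_ (cast-1+* x k y n eq) ⟩
    - (+ y * + n)                 ≡⟨ negate (+ y) (+ n) ⟩
    - + y * + n                   ∎))
    where
    open ≡-Reasoning
    regroup : ∀ k x → k * - x - + 1 ≡ - (+ 1 + x * k)
    regroup = solve-∀
    negate : ∀ y n → - (y * n) ≡ - y * n
    negate = solve-∀

  even-or-odd : ∀ z → ∃[ t ] (z ≡ + 2 * t ⊎ z ≡ + 1 + + 2 * t)
  even-or-odd z with z %ℕ 2 | a≡a%ℕn+[a/ℕn]*n z 2 | n%ℕd<d z 2
  ... | 0           | eq | _ = z /ℕ 2 , inj₁ (trans eq (even (z /ℕ 2)))
    where even : ∀ t → + 0 + t * + 2 ≡ + 2 * t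
          even = solve-∀
  ... | 1           | eq | _ = z /ℕ 2 , inj₂ (trans eq (odd (z /ℕ 2)))
    where odd : ∀ t → + 1 + t * + 2 ≡ + 1 + + 2 * t
          odd = solve-∀
  ... | suc (suc _) | _  | s≤s (s≤s ())

  even≉odd : ∀ {g} a b → + 2 * a ≈ + 1 + + 2 * b mod (2 ℕ.* g) → ⊥
  even≉odd {g} a b 2a≈1+2b = 2≢1 (ℕ.∣1⇒≡1 (∣⇒∣ᵤ 2∣1))
    where
    split : ∀ a b → + 2 * a - (+ 1 + + 2 * b) ≡ + 2 * (a - b - + 1) + + 1
    split = solve-∀
    2∣difference : + 2 ∣ + 2 * (a - b - + 1) + + 1
    2∣difference = subst (_ ∣_) (split a b)
      (_≈_mod_.divides-difference (≈[mod]-weaken (ℕ.m∣m*n g) 2a≈1+2b))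
    2∣1 : + 2 ∣ + 1
    2∣1 = ∣m+n∣m⇒∣n 2∣difference (∣m⇒∣m*n (a - b - + 1) ∣-refl)
    2≢1 : 2 ≢ 1
    2≢1 ()

module Reflections where

  import Data.Nat.Base as ℕ
  import Data.Nat.Properties as ℕ
  import Data.Nat.Divisibility as ℕ
  open import Data.Nat.GCD using (gcd; gcd[m,n]∣m; gcd[m,n]∣n)
  open import Data.Integer.Base using (+_; _+_; _-_; _*_; _%ℕ_)
  open import Data.Integer.Properties using (pos-*)
  open import Data.Integer.Tactic.RingSolver using (solve-∀)
  open Orbits
  open Blocks using (Mirror; mirror; σ-single-mirror; σ-pair-mirror; σ-range)
  open Congruences

  record Reflection (n p : ℕ) (f : ℕ → ℕ) : Set where
    field
      range   : PreservesRange (2 ℕ.* n) f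
      mirrors : ∀ {x} → InRange (2 ℕ.* n) x → + x + + f x ≈ + 1 + + 2 * + p mod (2 ℕ.* n)

  reflection-orbit : ∀ {N d s f g x y} → PreservesRange N f → PreservesRange N g →
    (∀ {z} → InRange N z → + z + + f z ≈ s mod d) →
    (∀ {z} → InRange N z → + z + + g z ≈ s mod d) →
    InRange N x → Reach f g x y → + y ≈ + x mod d ⊎ + x + + y ≈ s mod d
  reflection-orbit {N} {d} {s} {f} {g} {x} f-range g-range f-mirrors g-mirrors x∈ r =
    proj₂ (Reach-invariant P (step f-range f-mirrors) (step g-range g-mirrors) r
             (x∈ , inj₁ (≡⇒≈[mod] refl)))
    where
    Class : ℕ → Set
    Class z = + z ≈ + x mod d ⊎ + x + + z ≈ s mod d
    P : ℕ → Set
    P z = InRange N z × Class z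
    open ≈[mod]-Reasoning d
    step : ∀ {h} → PreservesRange N h → (∀ {z} → InRange N z → + z + + h z ≈ s mod d) →
           ∀ {z} → P z → P (h z)
    step {h} h-range h-mirrors {z} (z∈ , inj₁ z≈x) = h-range z∈ , inj₂ (begin
      + x + + h z ≈⟨ +-congʳ[mod] (+ h z) (≈[mod]-sym z≈x) ⟩
      + z + + h z ≈⟨ h-mirrors z∈ ⟩
      s           ∎)
    step {h} h-range h-mirrors {z} (z∈ , inj₂ x+z≈s) = h-range z∈ , inj₁ (+-cancelʳ[mod] {z = + z} (begin
      + h z + + z ≡⟨ commute (+ h z) (+ z) ⟩
      + z + + h z ≈⟨ h-mirrors z∈ ⟩
      s           ≈⟨ ≈[mod]-sym x+z≈s ⟩
      + x + + z   ∎))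
      where commute : ∀ a b → a + b ≡ b + a
            commute = solve-∀

  module _ {n p q k f g} (n>0 : 0 < n) (F : Reflection n p f) (G : Reflection n q g)
           (p≈q+k : + p ≈ + q + + k mod n) where

    private
      module F = Reflection F
      module G = Reflection G
      instance
        n≢0 : ℕ.NonZero n
        n≢0 = ℕ.>-nonZero n>0

    open ≈[mod]-Reasoning (2 ℕ.* n)

    fg-rotates : ∀ {x} → InRange (2 ℕ.* n) x → + f (g x) ≈ + x + + 2 * + k mod (2 ℕ.* n)
    fg-rotates {x} x∈ = +-cancelʳ[mod] {z = + g x} (begin
      + f (g x) + + g x             ≡⟨ commute (+ f (g x)) (+ g x) ⟩
      + g x + + f (g x)             ≈⟨ F.mirrors (G.range x∈) ⟩
      + 1 + + 2 * + p               ≈⟨ +-congˡ[mod] (+ 1) (*-scale[mod] 2 p≈q+k) ⟩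
      + 1 + + 2 * (+ q + + k)       ≡⟨ split (+ q) (+ k) ⟩
      + 1 + + 2 * + q + + 2 * + k   ≈⟨ +-congʳ[mod] (+ 2 * + k) (≈[mod]-sym (G.mirrors x∈)) ⟩
      + x + + g x + + 2 * + k       ≡⟨ swap (+ x) (+ g x) (+ 2 * + k) ⟩
      + x + + 2 * + k + + g x       ∎)
      where
      commute : ∀ a b → a + b ≡ b + a
      commute = solve-∀
      split : ∀ q k → + 1 + + 2 * (q + k) ≡ + 1 + + 2 * q + + 2 * k
      split = solve-∀
      swap : ∀ a b c → a + b + c ≡ a + c + b
      swap = solve-∀

    reach-by-rotations : ∀ j {x y} → InRange (2 ℕ.* n) x → InRange (2 ℕ.* n) y →
      + y ≈ + x + + 2 * (+ k * + j) mod (2 ℕ.* n) → Reach f g x y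
    reach-by-rotations zero {x} {y} x∈ y∈ y≈x = Reach-≡ (≈[mod]-injective x∈ y∈ (≈[mod]-sym (begin
      + y                       ≈⟨ y≈x ⟩
      + x + + 2 * (+ k * + 0)   ≡⟨ no-turn (+ x) (+ k) ⟩
      + x                       ∎)))
      where no-turn : ∀ x k → x + + 2 * (k * + 0) ≡ x
            no-turn = solve-∀
    reach-by-rotations (suc j) {x} {y} x∈ y∈ y≈x =
      Reach-trans (stepf (stepg here)) (reach-by-rotations j (F.range (G.range x∈)) y∈ (begin
        + y                                   ≈⟨ y≈x ⟩
        + x + + 2 * (+ k * (+ 1 + + j))       ≡⟨ one-turn (+ x) (+ k) (+ j) ⟩
        + x + + 2 * + k + + 2 * (+ k * + j)   ≈⟨ +-congʳ[mod] (+ 2 * (+ k * + j)) (≈[mod]-sym (fg-rotates x∈)) ⟩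
        + f (g x) + + 2 * (+ k * + j)         ∎))
      where one-turn : ∀ x k j → x + + 2 * (k * (+ 1 + j)) ≡ x + + 2 * k + + 2 * (k * j)
            one-turn = solve-∀

    reach-by-even : gcd k n ≡ 1 → ∀ t {x y} → InRange (2 ℕ.* n) x → InRange (2 ℕ.* n) y →
      + y ≈ + x + + 2 * t mod (2 ℕ.* n) → Reach f g x y
    reach-by-even gcd≡1 t {x} {y} x∈ y∈ y≈x+2t with coprime⇒invertible {k} {n} gcd≡1
    ... | u , ku≈1 = reach-by-rotations j x∈ y∈ (begin
      + y                     ≈⟨ y≈x+2t ⟩
      + x + + 2 * t           ≈⟨ +-congˡ[mod] (+ x) (≈[mod]-sym (*-scale[mod] 2 kj≈t)) ⟩
      + x + + 2 * (+ k * + j) ∎)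
      where
      j : ℕ
      j = (u * t) %ℕ n
      module Mod-n = ≈[mod]-Reasoning n
      commute : ∀ k u t → k * (u * t) ≡ t * (k * u)
      commute = solve-∀
      unit : ∀ t → t * + 1 ≡ t
      unit = solve-∀
      kj≈t : + k * + j ≈ t mod n
      kj≈t = Mod-n.begin
        + k * + j         Mod-n.≈⟨ *-congˡ[mod] (+ k) (%ℕ≈[mod] (u * t) n) ⟩
        + k * (u * t)     Mod-n.≡⟨ commute (+ k) u t ⟩
        t * (+ k * u)     Mod-n.≈⟨ *-congˡ[mod] t ku≈1 ⟩
        t * + 1           Mod-n.≡⟨ unit t ⟩
        t                 Mod-n.∎

    coprime⇒transitive : gcd k n ≡ 1 → ActsTransitively (2 ℕ.* n) f g
    coprime⇒transitive gcd≡1 x y x≥1 x≤2n y≥1 y≤2n with even-or-odd (+ y - + x)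
    ... | t , inj₁ y-x≡2t = reach-by-even gcd≡1 t x∈ y∈ (begin
      + y                 ≡⟨ rebuild (+ y) (+ x) ⟩
      + x + (+ y - + x)   ≡⟨ cong (_+_ (+ x)) y-x≡2t ⟩
      + x + + 2 * t       ∎)
      where
      x∈ = x≥1 , x≤2n
      y∈ = y≥1 , y≤2n
      rebuild : ∀ y x → y ≡ x + (y - x)
      rebuild = solve-∀
    ... | t , inj₂ y-x≡1+2t = Reach-trans (stepg here)
      (reach-by-even gcd≡1 (t + + x - + q) (G.range x∈) y∈ (≈[mod]-sym (begin
        + g x + + 2 * (t + + x - + q)                  ≡⟨ regroup (+ g x) t (+ x) (+ q) ⟩
        + x + + g x + (+ 2 * t + + x - + 2 * + q)      ≈⟨ +-congʳ[mod] (+ 2 * t + + x - + 2 * + q) (G.mirrors x∈) ⟩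
        + 1 + + 2 * + q + (+ 2 * t + + x - + 2 * + q)  ≡⟨ simplify (+ q) t (+ x) ⟩
        + x + (+ 1 + + 2 * t)                          ≡⟨ cong (_+_ (+ x)) y-x≡1+2t ⟨
        + x + (+ y - + x)                              ≡⟨ cancel (+ x) (+ y) ⟩
        + y                                            ∎)))
      where
      x∈ = x≥1 , x≤2n
      y∈ = y≥1 , y≤2n
      regroup : ∀ gx t x q → gx + + 2 * (t + x - q) ≡ x + gx + (+ 2 * t + x - + 2 * q)
      regroup = solve-∀
      simplify : ∀ q t x → + 1 + + 2 * q + (+ 2 * t + x - + 2 * q) ≡ x + (+ 1 + + 2 * t)
      simplify = solve-∀
      cancel : ∀ x y → x + (y - x) ≡ y
      cancel = solve-∀

    transitive⇒coprime : ActsTransitively (2 ℕ.* n) f g → gcd k n ≡ 1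
    transitive⇒coprime T =
      conclude (reflection-orbit F.range G.range f-mirrors g-mirrors 2n∈
                  (T (2 ℕ.* n) 2 (proj₁ 2n∈) (proj₂ 2n∈) (s≤s z≤n) 2≤2n))
      where
      d = gcd k n
      s = + 1 + + 2 * + p
      2d∣2n : 2 ℕ.* d ℕ.∣ 2 ℕ.* n
      2d∣2n = ℕ.*-monoʳ-∣ 2 (gcd[m,n]∣n k n)
      p≈q : + p ≈ + q mod d
      p≈q = Mod-d.begin
        + p         Mod-d.≈⟨ ≈[mod]-weaken (gcd[m,n]∣n k n) p≈q+k ⟩
        + q + + k   Mod-d.≈⟨ +-congˡ[mod] (+ q) (∣⇒≈[mod]0 (gcd[m,n]∣m k n)) ⟩
        + q + + 0   Mod-d.≡⟨ plus-zero (+ q) ⟩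
        + q         Mod-d.∎
        where
        module Mod-d = ≈[mod]-Reasoning d
        plus-zero : ∀ x → x + + 0 ≡ x
        plus-zero = solve-∀
      f-mirrors : ∀ {z} → InRange (2 ℕ.* n) z → + z + + f z ≈ s mod (2 ℕ.* d)
      f-mirrors z∈ = ≈[mod]-weaken 2d∣2n (F.mirrors z∈)
      g-mirrors : ∀ {z} → InRange (2 ℕ.* n) z → + z + + g z ≈ s mod (2 ℕ.* d)
      g-mirrors z∈ = ≈[mod]-trans (≈[mod]-weaken 2d∣2n (G.mirrors z∈))
        (+-congˡ[mod] (+ 1) (*-scale[mod] 2 (≈[mod]-sym p≈q)))
      2≤2n : 2 ≤ 2 ℕ.* n
      2≤2n = ℕ.*-monoʳ-≤ 2 n>0
      2n∈ : InRange (2 ℕ.* n) (2 ℕ.* n)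
      2n∈ = ℕ.≤-trans (s≤s z≤n) 2≤2n , ℕ.≤-refl
      double : ∀ m → + 2 * m + + 2 ≡ + 2 * (m + + 1)
      double = solve-∀
      conclude : + 2 ≈ + (2 ℕ.* n) mod (2 ℕ.* d) ⊎ + (2 ℕ.* n) + + 2 ≈ s mod (2 ℕ.* d) → d ≡ 1
      conclude (inj₁ 2≈2n) =
        ℕ.∣1⇒≡1 (ℕ.*-cancelˡ-∣ 2 (≈[mod]0⇒∣ (≈[mod]-trans 2≈2n (∣⇒≈[mod]0 2d∣2n))))
      conclude (inj₂ 2n+2≈s) = ⊥-elim (even≉odd {d} (+ n + + 1) (+ p)
        (subst (λ w → w ≈ s mod (2 ℕ.* d)) (trans (cong (_+ + 2) (pos-* 2 n)) (double (+ n))) 2n+2≈s))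

    Reflections-transitive⇔coprime : ActsTransitively (2 ℕ.* n) f g ⇔ gcd k n ≡ 1
    Reflections-transitive⇔coprime = mk⇔ transitive⇒coprime coprime⇒transitive

  private
    Mirror⇒≈[mod] : ∀ {c x y M} → Mirror c x y → + x + + y ≈ + 1 + + 2 * + c mod M
    Mirror⇒≈[mod] {c} (mirror _ _ x+y≡) =
      ≡⇒≈[mod] (trans (cong +_ x+y≡) (cong (_+_ (+ 1)) (pos-* 2 c)))

  σ-single-reflection : ∀ n → Reflection n n (σ (n ∷ []))
  σ-single-reflection n = record
    { range   = σ-range (n ∷ []) (ℕ.+-identityʳ n)
    ; mirrors = λ x∈ → Mirror⇒≈[mod] (σ-single-mirror n x∈)
    }

  σ-pair-reflection : ∀ a b {n} → a ℕ.+ b ≡ n → Reflection n a (σ (a ∷ b ∷ []))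
  σ-pair-reflection a b refl = record
    { range   = σ-range (a ∷ b ∷ []) (cong (a ℕ.+_) (ℕ.+-identityʳ b))
    ; mirrors = λ x∈ → [ Mirror⇒≈[mod] , (λ m → ≈[mod]-trans (Mirror⇒≈[mod] m) wrap-around) ]′
                         (σ-pair-mirror a b x∈)
    }
    where
    N = 2 ℕ.* (a ℕ.+ b)
    unwrap : ∀ a b → + 1 + + 2 * a + + 1 * (+ 2 * (a + b)) ≡ + 1 + + 2 * (a + (a + b))
    unwrap = solve-∀
    wrap-around : + 1 + + 2 * + (a ℕ.+ (a ℕ.+ b)) ≈ + 1 + + 2 * + a mod N
    wrap-around = subst (λ v → v ≈ _ mod N)
      (trans (cong (λ v → + 1 + + 2 * + a + + 1 * v) (pos-* 2 (a ℕ.+ b))) (unwrap (+ a) (+ b)))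
      (+-multiple[mod] (+ 1 + + 2 * + a) (+ 1))

open import Data.Nat.Base using (_+_; _*_; _≤ᵇ_)
open import Data.Nat.ListAction using (sum)
open import Level using (0ℓ)
open import Data.Nat.Properties
  using (+-comm; +-identityʳ; ≤-trans; m≤m+n; <⇒≤; ≰⇒>; m≤n⇒∃[o]m+o≡n; _≤?_)
open import Data.Nat.GCD using (gcd; gcd-comm)
open import Data.Nat.Tactic.RingSolver using (solve-∀)
open import Data.List.Relation.Unary.All using ([]; _∷_)
open import Function.Properties.Equivalence using (⇔-setoid) renaming (trans to ⇔-trans)
open import Relation.Nullary.Decidable.Core using (yes; no)
import Relation.Binary.Reasoning.Setoid as SetoidReasoning
open Orbits using (InRange; ActsTransitively; ActsTransitively-swap; ActsTransitively-conjugate)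
open Blocks using (Mirror-sym; σ-mirror; σ-single-mirror; σ-reverse; σ-range)
open Congruences using (+≡+⇒≈[mod])
open Reflections using (Reflections-transitive⇔coprime; σ-pair-reflection; σ-single-reflection)

module Folding (cs : List ℕ) (m c d N : ℕ)
               (sum≡m : sum cs ≡ m) (c+d≡m : c + d ≡ m) (m+c≡N : m + c ≡ N) where

  open import Data.Bool.Base using (if_then_else_)
  open import Data.Nat.Properties using (<⇒≱; m<m+n; *-monoʳ-≤; ≤ᵇ-reflects-≤)
  open import Data.Nat.ListAction.Properties using (sum-++)
  open import Relation.Nullary.Reflects using (ofʸ; ofⁿ)
  open Orbits
  open Blocks

  F G F′ G′ : ℕ → ℕ
  F  = σ (cs ++ c ∷ [])
  G  = σ (N ∷ [])
  F′ = σ cs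
  G′ = σ (c ∷ d ∷ [])

  -- The points of the last block of F are carried by G onto {1, …, 2c}.
  project : ℕ → ℕ
  project x = if x ≤ᵇ 2 * m then x else G x

  private
    variable
      x y ȳ : ℕ

  project-low : x ≤ 2 * m → project x ≡ x
  project-low {x} x≤2m with x ≤ᵇ 2 * m | ≤ᵇ-reflects-≤ x (2 * m)
  ... | true  | _      = refl
  ... | false | ofⁿ x≰ = ⊥-elim (x≰ x≤2m)

  project-high : ∀ {z} → 0 < z → project (2 * m + z) ≡ G (2 * m + z)
  project-high {z} z>0 with 2 * m + z ≤ᵇ 2 * m | ≤ᵇ-reflects-≤ (2 * m + z) (2 * m)
  ... | true  | ofʸ le = ⊥-elim (<⇒≱ (m<m+n (2 * m) z>0) le)
  ... | false | _      = refl

  2c≤2m : 2 * c ≤ 2 * m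
  2c≤2m = *-monoʳ-≤ 2 (subst (c ≤_) c+d≡m (m≤m+n c d))

  2m≤2N : 2 * m ≤ 2 * N
  2m≤2N = *-monoʳ-≤ 2 (subst (m ≤_) m+c≡N (m≤m+n m c))

  F-low : InRange (2 * m) x → F x ≡ F′ x
  F-low {x} (x≥1 , x≤2m) = σ-++ˡ cs (c ∷ []) (x≥1 , subst (λ s → x ≤ 2 * s) (sym sum≡m) x≤2m)

  F-high : Mirror c y ȳ → F (2 * m + ȳ) ≡ 2 * m + y
  F-high {ȳ = zero}  (mirror _ () _)
  F-high {ȳ = suc v} mir =
    trans (subst (λ s → F (2 * s + suc v) ≡ 2 * s + σ (c ∷ []) (suc v)) sum≡m (σ-++ʳ cs (c ∷ []) v))
          (cong (2 * m +_) (σ-mirror [] (Mirror-sym mir)))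

  fold-mirror : Mirror c y ȳ → Mirror N y (2 * m + ȳ)
  fold-mirror mir = subst (λ s → Mirror s _ _) m+c≡N (Mirror-shiftʳ m mir)

  G-fold : Mirror c y ȳ → G y ≡ 2 * m + ȳ
  G-fold mir = σ-mirror [] (fold-mirror mir)

  G-unfold : Mirror c y ȳ → G (2 * m + ȳ) ≡ y
  G-unfold mir = σ-mirror [] (Mirror-sym (fold-mirror mir))

  project-unfold : Mirror c y ȳ → project (2 * m + ȳ) ≡ y
  project-unfold mir = trans (project-high (Mirror.right>0 mir)) (G-unfold mir)

  G′-left : Mirror c y ȳ → G′ y ≡ ȳ
  G′-left mir = σ-mirror (d ∷ []) mir

  G-middle : ∀ w → suc w ≤ 2 * d → G (2 * c + suc w) ≡ G′ (2 * c + suc w)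
  G-middle w w≤2d with Mirror-exists d (s≤s z≤n , w≤2d)
  ... | z , mir = trans
    (σ-mirror [] (subst (λ s → Mirror s (2 * c + suc w) (2 * c + z)) c+m≡N
                    (Mirror-shiftʳ c (Mirror-shiftˡ c mir))))
    (sym (trans (σ-beyond c (d ∷ []) w) (cong (2 * c +_) (σ-mirror [] mir))))
    where
    c+m≡N : c + (c + d) ≡ N
    c+m≡N = trans (cong (c +_) c+d≡m) (trans (+-comm c m) m+c≡N)

  data BigPosition : ℕ → Set where
    low  : InRange (2 * m) x → BigPosition x
    high : Mirror c y ȳ → BigPosition (2 * m + ȳ)

  big-position : InRange (2 * N) x → BigPosition x
  big-position {x} (x≥1 , x≤2N) with block m x
  ... | inside x≤2m = low (x≥1 , x≤2m)
  ... | beyond w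
    with Mirror-exists c (s≤s z≤n , beyond-bound m c w (subst (λ s → _ ≤ 2 * s) (sym m+c≡N) x≤2N))
  ...   | _ , mir = high (Mirror-sym mir)

  data SmallPosition : ℕ → Set where
    left   : Mirror c y ȳ → SmallPosition y
    middle : ∀ w → suc w ≤ 2 * d → SmallPosition (2 * c + suc w)

  small-position : InRange (2 * m) y → SmallPosition y
  small-position {y} (y≥1 , y≤2m) with block c y
  ... | inside y≤2c = left (proj₂ (Mirror-exists c (y≥1 , y≤2c)))
  ... | beyond w    = middle w (beyond-bound c d w (subst (λ s → _ ≤ 2 * s) (sym c+d≡m) y≤2m))

  F-range : PreservesRange (2 * N) F
  F-range = σ-range (cs ++ c ∷ []) (trans (sum-++ cs (c ∷ []))
              (trans (cong₂ _+_ sum≡m (+-identityʳ c)) m+c≡N))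

  G-range : PreservesRange (2 * N) G
  G-range = σ-range (N ∷ []) (+-identityʳ N)

  F′-range : PreservesRange (2 * m) F′
  F′-range = σ-range cs sum≡m

  G′-range : PreservesRange (2 * m) G′
  G′-range = σ-range (c ∷ d ∷ []) (trans (cong (c +_) (+-identityʳ d)) c+d≡m)

  left-range : Mirror c y ȳ → InRange (2 * m) y
  left-range mir with Mirror-range mir
  ... | y≥1 , y≤2c = y≥1 , ≤-trans y≤2c 2c≤2m

  G′-reach : InRange (2 * m) y → Reach F G y (G′ y)
  G′-reach {y} y∈ with small-position y∈
  ... | left {ȳ = ȳ} mir = subst (Reach F G y) (begin
      G (F (G y))        ≡⟨ cong (λ v → G (F v)) (G-fold mir) ⟩
      G (F (2 * m + ȳ))  ≡⟨ cong G (F-high mir) ⟩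
      G (2 * m + y)      ≡⟨ G-unfold (Mirror-sym mir) ⟩
      ȳ                  ≡⟨ G′-left mir ⟨
      G′ y               ∎) (stepg (stepf (stepg here)))
    where open ≡-Reasoning
  ... | middle w w≤2d = subst (Reach F G _) (G-middle w w≤2d) (stepg here)

  project-range : InRange (2 * N) x → InRange (2 * m) (project x)
  project-range x∈ with big-position x∈
  ... | low x∈′  = subst (InRange (2 * m)) (sym (project-low (proj₂ x∈′))) x∈′
  ... | high mir = subst (InRange (2 * m)) (sym (project-unfold mir)) (left-range mir)

  project-reach : InRange (2 * N) x → Reach F G x (project x)
  project-reach x∈ with big-position x∈
  ... | low x∈′  = Reach-≡ (sym (project-low (proj₂ x∈′)))
  ... | high mir = subst (Reach F G _) (sym (project-high (Mirror.right>0 mir))) (stepg here)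

  project-reach⁻ : InRange (2 * N) x → Reach F G (project x) x
  project-reach⁻ x∈ with big-position x∈
  ... | low x∈′  = Reach-≡ (project-low (proj₂ x∈′))
  ... | high mir = subst₂ (Reach F G) (sym (project-unfold mir)) (G-fold mir) (stepg here)

  project-F : InRange (2 * N) x → Reach F′ G′ (project x) (project (F x))
  project-F x∈ with big-position x∈
  ... | low x∈′ = subst₂ (Reach F′ G′) (sym (project-low (proj₂ x∈′)))
      (sym (trans (cong project (F-low x∈′)) (project-low (proj₂ (F′-range x∈′)))))
      (stepf here)
  ... | high mir = subst₂ (Reach F′ G′) (sym (project-unfold mir))
      (trans (G′-left mir) (sym (trans (cong project (F-high mir)) (project-unfold (Mirror-sym mir)))))
      (stepg here)

  project-G : InRange (2 * N) x → Reach F′ G′ (project x) (project (G x))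
  project-G x∈ with big-position x∈
  project-G x∈ | high mir = Reach-≡ (trans (project-unfold mir)
      (sym (trans (cong project (G-unfold mir)) (project-low (proj₂ (left-range mir))))))
  project-G x∈ | low x∈′ with small-position x∈′
  ... | left mir = Reach-≡ (trans (project-low (proj₂ x∈′))
      (sym (trans (cong project (G-fold mir)) (project-unfold mir))))
  ... | middle w w≤2d = subst₂ (Reach F′ G′) (sym (project-low (proj₂ x∈′)))
      (sym (trans (cong project (G-middle w w≤2d)) (project-low (proj₂ (G′-range x∈′)))))
      (stepg here)

  folding : Reduction (2 * N) (2 * m) F G F′ G′
  folding = record
    { M≤N            = 2m≤2N
    ; f-range        = F-range
    ; g-range        = G-range
    ; f′-range       = F′-range
    ; g′-range       = G′-range
    ; f′-reach       = λ y∈ → subst (Reach F G _) (F-low y∈) (stepf here)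
    ; g′-reach       = G′-reach
    ; project        = project
    ; project-range  = project-range
    ; project-small  = λ y∈ → project-low (proj₂ y∈)
    ; project-reach  = project-reach
    ; project-reach⁻ = project-reach⁻
    ; project-f      = project-F
    ; project-g      = project-G
    }

  fold-transitive : ActsTransitively (2 * N) F G ⇔ ActsTransitively (2 * m) F′ G′
  fold-transitive = Reduction⇒ActsTransitively⇔ folding

module ⇔-Reasoning = SetoidReasoning (⇔-setoid 0ℓ)

private
  sum-pair : ∀ a b {n} → a + b ≡ n → sum (a ∷ b ∷ []) ≡ n
  sum-pair a b = trans (cong (a +_) (+-identityʳ b))

  sum-triple : ∀ a b c {n} → a + b + c ≡ n → sum (a ∷ b ∷ c ∷ []) ≡ n
  sum-triple a b c = trans (regroup a b c)
    where regroup : ∀ a b c → a + (b + (c + 0)) ≡ a + b + c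
          regroup = solve-∀

  composition₁ : ∀ {a n} → 0 < a → a ≡ n → IsComposition n (a ∷ [])
  composition₁ {a} a>0 a≡n = (a>0 ∷ []) , trans (+-identityʳ a) a≡n

  composition₂ : ∀ {a b n} → 0 < a → 0 < b → a + b ≡ n → IsComposition n (a ∷ b ∷ [])
  composition₂ {a} {b} a>0 b>0 a+b≡n = (a>0 ∷ b>0 ∷ []) , sum-pair a b a+b≡n

  composition₃ : ∀ {a b c n} → 0 < a → 0 < b → 0 < c → a + b + c ≡ n →
                 IsComposition n (a ∷ b ∷ c ∷ [])
  composition₃ {a} {b} {c} a>0 b>0 c>0 a+b+c≡n = (a>0 ∷ b>0 ∷ c>0 ∷ []) , sum-triple a b c a+b+c≡n

IsLieander⇔ActsTransitively : ∀ {n c⁺ c⁻} → IsComposition n c⁺ → IsComposition n c⁻ →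
  IsLieander n c⁺ c⁻ ⇔ ActsTransitively (2 * n) (σ c⁺) (σ c⁻)
IsLieander⇔ActsTransitively c⁺-composes c⁻-composes =
  mk⇔ (λ lieander → proj₂ (proj₂ lieander)) (λ T → c⁺-composes , c⁻-composes , T)

reverse-transitive : ∀ {n} cs → sum cs ≡ n →
  ActsTransitively (2 * n) (σ cs) (σ (n ∷ [])) → ActsTransitively (2 * n) (σ (reverse cs)) (σ (n ∷ []))
reverse-transitive {n} cs refl =
  ActsTransitively-conjugate h h-range h-involutive (σ-range cs refl) h-range commutes (λ _ → refl)
  where
  h : ℕ → ℕ
  h = σ (n ∷ [])
  h-range : Orbits.PreservesRange (2 * n) h
  h-range = σ-range (n ∷ []) (+-identityʳ n)
  h-involutive : ∀ {x} → InRange (2 * n) x → h (h x) ≡ x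
  h-involutive x∈ = σ-mirror [] (Mirror-sym (σ-single-mirror n x∈))
  commutes : ∀ {x} → InRange (2 * n) x → h (σ cs x) ≡ σ (reverse cs) (h x)
  commutes x∈ = σ-mirror [] (σ-reverse cs (σ-single-mirror n x∈))

pair-and-single : ∀ {n} a b → 0 < n → a + b ≡ n →
  ActsTransitively (2 * n) (σ (a ∷ b ∷ [])) (σ (n ∷ [])) ⇔ gcd a n ≡ 1
pair-and-single {n} a b n>0 a+b≡n = Reflections-transitive⇔coprime {k = a} n>0
  (σ-pair-reflection a b a+b≡n) (σ-single-reflection n) (+≡+⇒≈[mod] a n a (+-comm a n))

two-pairs : ∀ {n} a b c d → 0 < n → a + b ≡ n → c + d ≡ n →
  ActsTransitively (2 * n) (σ (a ∷ b ∷ [])) (σ (c ∷ d ∷ [])) ⇔ gcd (a + d) n ≡ 1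
two-pairs {n} a b c d n>0 a+b≡n c+d≡n = Reflections-transitive⇔coprime {k = a + d} n>0
  (σ-pair-reflection a b a+b≡n) (σ-pair-reflection c d c+d≡n)
  (+≡+⇒≈[mod] a c (a + d) (trans (cong (a +_) (sym c+d≡n)) (swap a c d)))
  where swap : ∀ a c d → a + (c + d) ≡ c + (a + d)
        swap = solve-∀

triple-and-single-folded : ∀ {n} a b c → 0 < a → c ≤ a + b → a + b + c ≡ n →
  ActsTransitively (2 * n) (σ (a ∷ b ∷ c ∷ [])) (σ (n ∷ [])) ⇔ gcd (a + b) (b + c) ≡ 1
triple-and-single-folded {n} a b c a>0 c≤a+b a+b+c≡n with m≤n⇒∃[o]m+o≡n c≤a+b
... | d , c+d≡a+b = begin
  ActsTransitively (2 * n) (σ (a ∷ b ∷ c ∷ [])) (σ (n ∷ []))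
    ≈⟨ Folding.fold-transitive (a ∷ b ∷ []) (a + b) c d n (sum-pair a b refl) c+d≡a+b a+b+c≡n ⟩
  ActsTransitively (2 * (a + b)) (σ (a ∷ b ∷ [])) (σ (c ∷ d ∷ []))
    ≈⟨ ActsTransitively-swap ⟩
  ActsTransitively (2 * (a + b)) (σ (c ∷ d ∷ [])) (σ (a ∷ b ∷ []))
    ≈⟨ two-pairs c d a b (≤-trans a>0 (m≤m+n a b)) c+d≡a+b refl ⟩
  gcd (c + b) (a + b) ≡ 1
    ≡⟨ cong (_≡ 1) (trans (gcd-comm (c + b) (a + b)) (cong (gcd (a + b)) (+-comm c b))) ⟩
  gcd (a + b) (b + c) ≡ 1 ∎
  where open ⇔-Reasoning

triple-and-single : ∀ {n} a b c → 0 < a → 0 < c → a + b + c ≡ n →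
  ActsTransitively (2 * n) (σ (a ∷ b ∷ c ∷ [])) (σ (n ∷ [])) ⇔ gcd (a + b) (b + c) ≡ 1
triple-and-single {n} a b c a>0 c>0 a+b+c≡n with c ≤? a + b
... | yes c≤a+b = triple-and-single-folded a b c a>0 c≤a+b a+b+c≡n
... | no  c≰a+b = begin
  ActsTransitively (2 * n) (σ (a ∷ b ∷ c ∷ [])) (σ (n ∷ []))
    ≈⟨ mk⇔ (reverse-transitive (a ∷ b ∷ c ∷ []) (sum-triple a b c a+b+c≡n))
           (reverse-transitive (c ∷ b ∷ a ∷ []) (sum-triple c b a c+b+a≡n)) ⟩
  ActsTransitively (2 * n) (σ (c ∷ b ∷ a ∷ [])) (σ (n ∷ []))
    ≈⟨ triple-and-single-folded c b a c>0 a≤c+b c+b+a≡n ⟩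
  gcd (c + b) (b + a) ≡ 1
    ≡⟨ cong (_≡ 1) (trans (gcd-comm (c + b) (b + a)) (cong₂ gcd (+-comm b a) (+-comm c b))) ⟩
  gcd (a + b) (b + c) ≡ 1 ∎
  where
  open ⇔-Reasoning
  reorder : ∀ a b c → c + b + a ≡ a + b + c
  reorder = solve-∀
  c+b+a≡n : c + b + a ≡ n
  c+b+a≡n = trans (reorder a b c) a+b+c≡n
  a≤c+b : a ≤ c + b
  a≤c+b = ≤-trans (m≤m+n a b) (≤-trans (<⇒≤ (≰⇒> c≰a+b)) (m≤m+n c b))

lemma2 : (n : ℕ) → 0 < n →
    ((a b c : ℕ) → 0 < a → 0 < b → 0 < c → a + b ≡ n → c ≡ n →
      (IsLieander n (a ∷ b ∷ []) (c ∷ []) ⇔ gcd a n ≡ 1))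
    × ((a b c d : ℕ) → 0 < a → 0 < b → 0 < c → 0 < d → a + b + c ≡ n → d ≡ n →
      (IsLieander n (a ∷ b ∷ c ∷ []) (d ∷ []) ⇔ gcd (a + b) (b + c) ≡ 1))
    × ((a b c d : ℕ) → 0 < a → 0 < b → 0 < c → 0 < d → a + b ≡ n → c + d ≡ n →
      (IsLieander n (a ∷ b ∷ []) (c ∷ d ∷ []) ⇔ gcd (a + d) n ≡ 1))
lemma2 n n>0 =
    (λ { a b c a>0 b>0 c>0 a+b≡n refl → ⇔-trans
         (IsLieander⇔ActsTransitively (composition₂ a>0 b>0 a+b≡n) (composition₁ c>0 refl))
         (pair-and-single a b n>0 a+b≡n) })
  , (λ { a b c d a>0 b>0 c>0 d>0 a+b+c≡n refl → ⇔-trans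
         (IsLieander⇔ActsTransitively (composition₃ a>0 b>0 c>0 a+b+c≡n) (composition₁ d>0 refl))
         (triple-and-single a b c a>0 c>0 a+b+c≡n) })
  , (λ a b c d a>0 b>0 c>0 d>0 a+b≡n c+d≡n → ⇔-trans
         (IsLieander⇔ActsTransitively (composition₂ a>0 b>0 a+b≡n) (composition₂ c>0 d>0 c+d≡n))
         (two-pairs a b c d n>0 a+b≡n c+d≡n))
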